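{- If $;\vdash t:\S^n\mathbf{Bool}$ is derivable in $\mathbf{DLAL_B}$ (for some $n\in\mathbb{N}$), then (1) $t$ is not an abstraction; (2) if $t$ is in $\beta\delta$-normal form, then $t=T$ or $t=F$.
   Context: System $\mathbf{DLAL_B}$. Types: $A,B::=\alpha\mid A\multimap B\mid A\Rightarrow B\mid \S A\mid \forall\alpha.A\mid \mathbf{Bool}$ ($\S^n A$ means $n$ copies of $\S$ before $A$). Terms of $\Lambda_B$: $t,u,v::=x\mid F\mid T\mid \lambda x.t\mid t\,u\mid \mathrm{if}\ t\ \mathrm{then}\ u\ \mathrm{else}\ v$. Besides $\beta$-reduction there is $\delta$-reduction, the contextual closure of $(\mathrm{if}\ T\ \mathrm{then}\ u\ \mathrm{else}\ v)\to u$ and $(\mathrm{if}\ F\ \mathrm{then}\ u\ \mathrm{else}\ v)\to v$. Judgements are $\Gamma;\Delta\vdash t:A$ where $\Gamma$ (non-linear) and $\Delta$ (linear) assign types to distinct variables, with disjoint domains. Rules: (Id) $;x:A\vdash x:A$. ($\multimap$i) from $\Gamma;\Delta,x:A\vdash t:B$ infer $\Gamma;\Delta\vdash\lambda x.t:A\multimap B$. ($\multimap$e) from $\Gamma_1;\Delta_1\vdash t:A\multimap B$ and $\Gamma_2;\Delta_2\vdash u:A$ infer $\Gamma_1,\Gamma_2;\Delta_1,\Delta_2\vdash t\,u:B$. ($\Rightarrow$i) from $\Gamma,x:A;\Delta\vdash t:B$ infer $\Gamma;\Delta\vdash \lambda x.t:A\Rightarrow B$. ($\Rightarrow$e) from $\Gamma;\Delta\vdash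 t:A\Rightarrow B$ and $;z:C\vdash u:A$ infer $\Gamma,z:C;\Delta\vdash t\,u:B$ (the right premise may also be $;\vdash u:A$, with conclusion $\Gamma;\Delta\vdash t\,u:B$). (Weak) from $\Gamma_1;\Delta_1\vdash t:A$ infer $\Gamma_1,\Gamma_2;\Delta_1,\Delta_2\vdash t:A$. (Cntr) from $x_1:A,x_2:A,\Gamma;\Delta\vdash t:B$ infer $x:A,\Gamma;\Delta\vdash t[x/x_1,x/x_2]:B$. ($\S$i) from $;\Gamma,\Delta\vdash t:A$ infer $\Gamma;\S\Delta\vdash t:\S A$ ($\S\Delta$ prefixes $\S$ to every type of $\Delta$). ($\S$e) from $\Gamma_1;\Delta_1\vdash u:\S A$ and $\Gamma_2;x:\S A,\Delta_2\vdash t:B$ infer $\Gamma_1,\Gamma_2;\Delta_1,\Delta_2\vdash t[u/x]:B$. ($\forall$i) from $\Gamma;\Delta\vdash t:A$ infer $\Gamma;\Delta\vdash t:\forall\alpha.A$ if $\alpha$ is not free in $\Gamma,\Delta$. ($\forall$e) from $\Gamma;\Delta\vdash t:\forall\alpha.A$ infer $\Gamma;\Delta\vdash t:A[B/\alpha]$. ($B_0$i) $;\vdash F:\mathbf{Bool}$; ($B_1$i) $;\vdash T:\mathbf{Bool}$. ($B$e) from $\Gamma;\Delta\vdash M_0:\S^k\mathbf{Bool}$ ($k\in\mathbb{N}$), $\Gamma;\Delta\vdash M_1:A$, $\Gamma;\Delta\vdash M_2:A$ infer $\Gamma;\Delta\vdash \mathrm{if}\ M_0\ \mathrm{then}\ M_1\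 \mathrm{else}\ M_2:A$. -}

module Defs where

open import Data.Nat using (ℕ; zero; suc; _<ᵇ_; _≟_)
open import Data.Bool using (if_then_else_)
open import Data.List using (List; []; _∷_; _++_; map; replicate)
open import Data.List.Relation.Unary.All using (All)
open import Data.Maybe using (Maybe; just; nothing)
open import Data.Product using (∃)
open import Relation.Nullary using (¬_; yes; no)
open import Relation.Binary.PropositionalEquality using (_≡_; _≢_)

-- Types of DLAL_B.  Type variables are de Bruijn indices (so that
-- alpha-equivalent types are syntactically equal).

infixr 20 _⊸_ _⇒_

data Ty : Set where
  tv   : ℕ → Ty
  _⊸_  : Ty → Ty → Ty
  _⇒_  : Ty → Ty → Ty
  §_   : Ty → Ty
  ∀ₜ   : Ty → Ty          -- ∀α.A, α bound as index 0
  Bool : Ty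

§^ : ℕ → Ty → Ty
§^ zero    A = A
§^ (suc n) A = § (§^ n A)

shiftT : ℕ → Ty → Ty
shiftT c (tv n)  = if n <ᵇ c then tv n else tv (suc n)
shiftT c (A ⊸ B) = shiftT c A ⊸ shiftT c B
shiftT c (A ⇒ B) = shiftT c A ⇒ shiftT c B
shiftT c (§ A)   = § shiftT c A
shiftT c (∀ₜ A)  = ∀ₜ (shiftT (suc c) A)
shiftT c Bool    = Bool

substVar : ℕ → Ty → ℕ → Ty
substVar zero    B zero    = B
substVar zero    B (suc n) = tv n
substVar (suc c) B zero    = tv zero
substVar (suc c) B (suc n) = shiftT 0 (substVar c B n)

-- substT c B A : substitute B for variable c in A (decrementing
-- the variables above c), capture-avoiding
substT : ℕ → Ty → Ty → Ty
substT c B (tv n)  = substVar c B n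
substT c B (A ⊸ A') = substT c B A ⊸ substT c B A'
substT c B (A ⇒ A') = substT c B A ⇒ substT c B A'
substT c B (§ A)   = § substT c B A
substT c B (∀ₜ A)  = ∀ₜ (substT (suc c) B A)
substT c B Bool    = Bool

-- A[B/α] for A = body of ∀α.A
_[_]ₜ : Ty → Ty → Ty
A [ B ]ₜ = substT 0 B A

-- Terms of Λ_B, de Bruijn indices (alpha-equivalence = equality)

data Tm : Set where
  var : ℕ → Tm
  tF  : Tm
  tT  : Tm
  lam : Tm → Tm
  app : Tm → Tm → Tm
  ite : Tm → Tm → Tm → Tm

liftR : (ℕ → ℕ) → ℕ → ℕ
liftR ρ zero    = zero
liftR ρ (suc n) = suc (ρ n)

ren : (ℕ → ℕ) → Tm → Tm
ren ρ (var n)     = var (ρ n)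
ren ρ tF          = tF
ren ρ tT          = tT
ren ρ (lam t)     = lam (ren (liftR ρ) t)
ren ρ (app t u)   = app (ren ρ t) (ren ρ u)
ren ρ (ite t u v) = ite (ren ρ t) (ren ρ u) (ren ρ v)

liftS : (ℕ → Tm) → ℕ → Tm
liftS σ zero    = var zero
liftS σ (suc n) = ren suc (σ n)

sub : (ℕ → Tm) → Tm → Tm
sub σ (var n)     = σ n
sub σ tF          = tF
sub σ tT          = tT
sub σ (lam t)     = lam (sub (liftS σ) t)
sub σ (app t u)   = app (sub σ t) (sub σ u)
sub σ (ite t u v) = ite (sub σ t) (sub σ u) (sub σ v)

-- t[u/x], keeping all other indices unchanged (used in (§e))
substAt : ℕ → Tm → ℕ → Tm
substAt x u n with n ≟ x
... | yes _ = u
... | no  _ = var n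

β-σ : Tm → ℕ → Tm
β-σ u zero    = u
β-σ u (suc n) = var n

infix 4 _⟶_
data _⟶_ : Tm → Tm → Set where
  β     : ∀ {t u} → app (lam t) u ⟶ sub (β-σ u) t
  δT    : ∀ {u v} → ite tT u v ⟶ u
  δF    : ∀ {u v} → ite tF u v ⟶ v
  ξlam  : ∀ {t t'} → t ⟶ t' → lam t ⟶ lam t'
  ξappl : ∀ {t t' u} → t ⟶ t' → app t u ⟶ app t' u
  ξappr : ∀ {t u u'} → u ⟶ u' → app t u ⟶ app t u'
  ξite₀ : ∀ {t t' u v} → t ⟶ t' → ite t u v ⟶ ite t' u v
  ξite₁ : ∀ {t u u' v} → u ⟶ u' → ite t u v ⟶ ite t u' v
  ξite₂ : ∀ {t u v v'} → v ⟶ v' → ite t u v ⟶ ite t u v'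

Normal : Tm → Set
Normal t = ∀ t' → ¬ (t ⟶ t')

-- Contexts.  Position i of a context describes term variable i:
--   ○ : not declared,  lin A : x_i : A in Δ,  nlin A : x_i : A in Γ.
-- Distinctness and disjointness of domains are automatic.

data Slot : Set where
  ○    : Slot
  lin  : Ty → Slot
  nlin : Ty → Slot

Ctx : Set
Ctx = List Slot

Empty : Ctx → Set
Empty Ψ = All (_≡ ○) Ψ

-- Γ1,Γ2;Δ1,Δ2 : disjoint union of two contexts
data Merge : Ctx → Ctx → Ctx → Set where
  []  : Merge [] [] []
  l   : ∀ {s a b c} → Merge a b c → Merge (s ∷ a) (○ ∷ b) (s ∷ c)
  r   : ∀ {s a b c} → Merge a b c → Merge (○ ∷ a) (s ∷ b) (s ∷ c)

-- Ψ₁ ≼ Ψ : Ψ is Ψ₁ extended with further declarations (weakening)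
data _≼_ : Ctx → Ctx → Set where
  []   : ∀ {Ψ} → [] ≼ Ψ
  skip : ∀ {s a b} → a ≼ b → (○ ∷ a) ≼ (s ∷ b)
  keep : ∀ {s a b} → a ≼ b → (s ∷ a) ≼ (s ∷ b)

-- the right premise of (⇒e): ;z:C ⊢ u : A  or  ;⊢ u : A
data Small : Ctx → Set where
  none : ∀ {Ψ} → Empty Ψ → Small Ψ
  skip : ∀ {Ψ} → Small Ψ → Small (○ ∷ Ψ)
  here : ∀ {C Ψ} → Empty Ψ → Small (lin C ∷ Ψ)

bang : Ctx → Ctx
bang []            = []
bang (○ ∷ Ψ)       = ○ ∷ bang Ψ
bang (lin A ∷ Ψ)   = nlin A ∷ bang Ψ
bang (nlin A ∷ Ψ)  = nlin A ∷ bang Ψ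

-- (§i): premise context  ;Γ,Δ  (only linear declarations),
-- conclusion  Γ;§Δ
data SecCtx : Ctx → Ctx → Set where
  []   : SecCtx [] []
  emp  : ∀ {a b} → SecCtx a b → SecCtx (○ ∷ a) (○ ∷ b)
  toΓ  : ∀ {A a b} → SecCtx a b → SecCtx (lin A ∷ a) (nlin A ∷ b)
  toΔ  : ∀ {A a b} → SecCtx a b → SecCtx (lin A ∷ a) (lin (§ A) ∷ b)

lookupC : Ctx → ℕ → Maybe Slot
lookupC []      _       = nothing
lookupC (s ∷ Ψ) zero    = just s
lookupC (s ∷ Ψ) (suc n) = lookupC Ψ n

upd : Ctx → ℕ → Slot → Ctx
upd []      _       _  = []
upd (_ ∷ Ψ) zero    s' = s' ∷ Ψ
upd (s ∷ Ψ) (suc n) s' = s ∷ upd Ψ n s'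

shiftS : Slot → Slot
shiftS ○        = ○
shiftS (lin A)  = lin (shiftT 0 A)
shiftS (nlin A) = nlin (shiftT 0 A)

-- renaming x₁ ↦ x, x₂ ↦ x  (for (Cntr))
cntrR : ℕ → ℕ → ℕ → ℕ → ℕ
cntrR i j k n with n ≟ i | n ≟ j
... | yes _ | _     = k
... | no _  | yes _ = k
... | no _  | no _  = n

-- Typing judgement  Ψ ⊢ t ∶ A  (Ψ encodes Γ;Δ)

infix 3 _⊢_∶_
data _⊢_∶_ : Ctx → Tm → Ty → Set where
  Id   : ∀ {A} (i : ℕ) → replicate i ○ ++ lin A ∷ [] ⊢ var i ∶ A
  ⊸i   : ∀ {Ψ t A B} → lin A ∷ Ψ ⊢ t ∶ B → Ψ ⊢ lam t ∶ A ⊸ B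
  ⊸e   : ∀ {Ψ₁ Ψ₂ Ψ t u A B} → Ψ₁ ⊢ t ∶ A ⊸ B → Ψ₂ ⊢ u ∶ A →
         Merge Ψ₁ Ψ₂ Ψ → Ψ ⊢ app t u ∶ B
  ⇒i   : ∀ {Ψ t A B} → nlin A ∷ Ψ ⊢ t ∶ B → Ψ ⊢ lam t ∶ A ⇒ B
  ⇒e   : ∀ {Ψ₁ Ψ₂ Ψ t u A B} → Ψ₁ ⊢ t ∶ A ⇒ B → Ψ₂ ⊢ u ∶ A → Small Ψ₂ →
         Merge Ψ₁ (bang Ψ₂) Ψ → Ψ ⊢ app t u ∶ B
  Weak : ∀ {Ψ₁ Ψ t A} → Ψ₁ ⊢ t ∶ A → Ψ₁ ≼ Ψ → Ψ ⊢ t ∶ A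
  Cntr : ∀ {Ψ t A B} (i j k : ℕ) → i ≢ j →
         lookupC Ψ i ≡ just (nlin A) → lookupC Ψ j ≡ just (nlin A) →
         lookupC (upd (upd Ψ i ○) j ○) k ≡ just ○ →
         Ψ ⊢ t ∶ B →
         upd (upd (upd Ψ i ○) j ○) k (nlin A) ⊢ ren (cntrR i j k) t ∶ B
  §i   : ∀ {Ψ₁ Ψ t A} → Ψ₁ ⊢ t ∶ A → SecCtx Ψ₁ Ψ → Ψ ⊢ t ∶ § A
  §e   : ∀ {Ψ₁ Ψ₂ Ψ t u A B} (x : ℕ) → Ψ₁ ⊢ u ∶ § A →
         lookupC Ψ₂ x ≡ just (lin (§ A)) → Ψ₂ ⊢ t ∶ B →
         Merge Ψ₁ (upd Ψ₂ x ○) Ψ → Ψ ⊢ sub (substAt x u) t ∶ B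
  ∀i   : ∀ {Ψ t A} → map shiftS Ψ ⊢ t ∶ A → Ψ ⊢ t ∶ ∀ₜ A
  ∀e   : ∀ {Ψ t A} (B : Ty) → Ψ ⊢ t ∶ ∀ₜ A → Ψ ⊢ t ∶ A [ B ]ₜ
  B₀i  : [] ⊢ tF ∶ Bool
  B₁i  : [] ⊢ tT ∶ Bool
  Be   : ∀ {Ψ M₀ M₁ M₂ A} (k : ℕ) → Ψ ⊢ M₀ ∶ §^ k Bool →
         Ψ ⊢ M₁ ∶ A → Ψ ⊢ M₂ ∶ A → Ψ ⊢ ite M₀ M₁ M₂ ∶ A

module Submission where

-- Call a term Stuck if it is neither an abstraction nor βδ-normal.  Every
-- type A is read, under an environment ρ assigning predicates on terms to
-- type variables, as a predicate ⟦ A ⟧ ρ: Bool means "boolean-like" (not an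
-- abstraction, and T or F when normal), both arrows mean "function-like"
-- (an abstraction when normal), § is transparent and ∀α.A is A read with
-- α ↦ Stuck.  Stuck terms satisfy every such predicate, and since ⟦ A ⟧ ρ
-- is monotone in ρ, reading α as Stuck is the strongest instance, which
-- validates (∀e).  Applying a function-like term, or branching on a
-- boolean-like one, gives a Stuck term; this validates (⊸e), (⇒e), (Be).

open import Defs
open import Data.Nat using (ℕ; zero; suc; _+_; _<ᵇ_; _≟_)
open import Data.Bool using (true; false; if_then_else_)
open import Data.List using ([]; _∷_; _++_; map; replicate)
open import Data.List.Relation.Unary.All using (_∷_)
open import Data.Maybe using (Maybe; just)
open import Data.Maybe.Properties using (just-injective)
open import Data.Product using (Σ; _×_; _,_)
open import Data.Sum using (_⊎_; inj₁; inj₂)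
open import Data.Unit using (⊤; tt)
open import Data.Empty using (⊥-elim)
open import Level using (0ℓ)
open import Relation.Nullary using (¬_; yes; no)
open import Relation.Unary using (Pred; _⊆_)
open import Relation.Binary.PropositionalEquality

-- Renaming and substitution on terms.  The laws below are needed because
-- (Cntr) and (§e) type a renamed resp. substituted term.

cong₃ : ∀ {A B C D : Set} (f : A → B → C → D) {a a' b b' c c'} →
        a ≡ a' → b ≡ b' → c ≡ c' → f a b c ≡ f a' b' c'
cong₃ f refl refl refl = refl

ren-cong : ∀ {ρ ρ'} → (∀ n → ρ n ≡ ρ' n) → ∀ t → ren ρ t ≡ ren ρ' t
ren-cong e (var n)     = cong var (e n)
ren-cong e tF          = refl
ren-cong e tT          = refl
ren-cong e (lam t)     = cong lam (ren-cong lift-e t)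
  where lift-e : ∀ n → liftR _ n ≡ liftR _ n
        lift-e zero    = refl
        lift-e (suc n) = cong suc (e n)
ren-cong e (app t u)   = cong₂ app (ren-cong e t) (ren-cong e u)
ren-cong e (ite t u v) = cong₃ ite (ren-cong e t) (ren-cong e u) (ren-cong e v)

sub-cong : ∀ {σ σ'} → (∀ n → σ n ≡ σ' n) → ∀ t → sub σ t ≡ sub σ' t
sub-cong e (var n)     = e n
sub-cong e tF          = refl
sub-cong e tT          = refl
sub-cong e (lam t)     = cong lam (sub-cong lift-e t)
  where lift-e : ∀ n → liftS _ n ≡ liftS _ n
        lift-e zero    = refl
        lift-e (suc n) = cong (ren suc) (e n)
sub-cong e (app t u)   = cong₂ app (sub-cong e t) (sub-cong e u)
sub-cong e (ite t u v) = cong₃ ite (sub-cong e t) (sub-cong e u) (sub-cong e v)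

ren-ren : ∀ ρ ρ' t → ren ρ (ren ρ' t) ≡ ren (λ n → ρ (ρ' n)) t
ren-ren ρ ρ' (var n)     = refl
ren-ren ρ ρ' tF          = refl
ren-ren ρ ρ' tT          = refl
ren-ren ρ ρ' (lam t)     =
  cong lam (trans (ren-ren (liftR ρ) (liftR ρ') t) (ren-cong lift-comp t))
  where lift-comp : ∀ n → liftR ρ (liftR ρ' n) ≡ liftR (λ n → ρ (ρ' n)) n
        lift-comp zero    = refl
        lift-comp (suc n) = refl
ren-ren ρ ρ' (app t u)   = cong₂ app (ren-ren ρ ρ' t) (ren-ren ρ ρ' u)
ren-ren ρ ρ' (ite t u v) = cong₃ ite (ren-ren ρ ρ' t) (ren-ren ρ ρ' u) (ren-ren ρ ρ' v)

sub-ren : ∀ σ ρ t → sub σ (ren ρ t) ≡ sub (λ n → σ (ρ n)) t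
sub-ren σ ρ (var n)     = refl
sub-ren σ ρ tF          = refl
sub-ren σ ρ tT          = refl
sub-ren σ ρ (lam t)     =
  cong lam (trans (sub-ren (liftS σ) (liftR ρ) t) (sub-cong lift-comp t))
  where lift-comp : ∀ n → liftS σ (liftR ρ n) ≡ liftS (λ n → σ (ρ n)) n
        lift-comp zero    = refl
        lift-comp (suc n) = refl
sub-ren σ ρ (app t u)   = cong₂ app (sub-ren σ ρ t) (sub-ren σ ρ u)
sub-ren σ ρ (ite t u v) = cong₃ ite (sub-ren σ ρ t) (sub-ren σ ρ u) (sub-ren σ ρ v)

ren-sub : ∀ ρ σ t → ren ρ (sub σ t) ≡ sub (λ n → ren ρ (σ n)) t
ren-sub ρ σ (var n)     = refl
ren-sub ρ σ tF          = refl
ren-sub ρ σ tT          = refl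
ren-sub ρ σ (lam t)     =
  cong lam (trans (ren-sub (liftR ρ) (liftS σ) t) (sub-cong lift-comp t))
  where lift-comp : ∀ n → ren (liftR ρ) (liftS σ n) ≡ liftS (λ n → ren ρ (σ n)) n
        lift-comp zero    = refl
        lift-comp (suc n) = trans (ren-ren (liftR ρ) suc (σ n)) (sym (ren-ren suc ρ (σ n)))
ren-sub ρ σ (app t u)   = cong₂ app (ren-sub ρ σ t) (ren-sub ρ σ u)
ren-sub ρ σ (ite t u v) = cong₃ ite (ren-sub ρ σ t) (ren-sub ρ σ u) (ren-sub ρ σ v)

sub-sub : ∀ σ τ t → sub σ (sub τ t) ≡ sub (λ n → sub σ (τ n)) t
sub-sub σ τ (var n)     = refl
sub-sub σ τ tF          = refl
sub-sub σ τ tT          = refl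
sub-sub σ τ (lam t)     =
  cong lam (trans (sub-sub (liftS σ) (liftS τ) t) (sub-cong lift-comp t))
  where lift-comp : ∀ n → sub (liftS σ) (liftS τ n) ≡ liftS (λ n → sub σ (τ n)) n
        lift-comp zero    = refl
        lift-comp (suc n) = trans (sub-ren (liftS σ) suc (τ n)) (sym (ren-sub suc σ (τ n)))
sub-sub σ τ (app t u)   = cong₂ app (sub-sub σ τ t) (sub-sub σ τ u)
sub-sub σ τ (ite t u v) = cong₃ ite (sub-sub σ τ t) (sub-sub σ τ u) (sub-sub σ τ v)

sub-id : ∀ t → sub var t ≡ t
sub-id (var n)     = refl
sub-id tF          = refl
sub-id tT          = refl
sub-id (lam t)     = cong lam (trans (sub-cong lift-var t) (sub-id t))
  where lift-var : ∀ n → liftS var n ≡ var n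
        lift-var zero    = refl
        lift-var (suc n) = refl
sub-id (app t u)   = cong₂ app (sub-id t) (sub-id u)
sub-id (ite t u v) = cong₃ ite (sub-id t) (sub-id u) (sub-id v)

NotLam : Pred Tm 0ℓ
NotLam t = ∀ u → t ≢ lam u

-- the interpretation of Bool; it is exactly the conclusion of the theorem
BoolLike : Pred Tm 0ℓ
BoolLike t = NotLam t × (Normal t → t ≡ tT ⊎ t ≡ tF)

FunLike : Pred Tm 0ℓ
FunLike t = Normal t → Σ Tm λ u → t ≡ lam u

-- the terms lying in the interpretation of every type
Stuck : Pred Tm 0ℓ
Stuck t = NotLam t × ¬ Normal t

stuck-boolLike : Stuck ⊆ BoolLike
stuck-boolLike (notLam , abnormal) = notLam , λ normal → ⊥-elim (abnormal normal)

stuck-funLike : Stuck ⊆ FunLike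
stuck-funLike (_ , abnormal) normal = ⊥-elim (abnormal normal)

lam-funLike : ∀ t → FunLike (lam t)
lam-funLike t _ = t , refl

-- an application of a function-like term is a β-redex or has a redex in
-- its head, so it is stuck; this is what validates (⊸e) and (⇒e)
app-stuck : ∀ {s} u → FunLike s → Stuck (app s u)
app-stuck {s} u funLike = (λ _ ()) , abnormal
  where
  abnormal : ¬ Normal (app s u)
  abnormal normal with funLike (λ s' s⟶s' → normal (app s' u) (ξappl s⟶s'))
  ... | w , refl = normal _ β

-- likewise a conditional on a boolean-like term, validating (Be)
ite-stuck : ∀ {b} u v → BoolLike b → Stuck (ite b u v)
ite-stuck {b} u v (_ , normal⇒bool) = (λ _ ()) , abnormal
  where
  abnormal : ¬ Normal (ite b u v)
  abnormal normal with normal⇒bool (λ b' b⟶b' → normal (ite b' u v) (ξite₀ b⟶b'))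
  ... | inj₁ refl = normal _ δT
  ... | inj₂ refl = normal _ δF

Env : Set₁
Env = ℕ → Pred Tm 0ℓ

infixr 5 _∷ₑ_
_∷ₑ_ : Pred Tm 0ℓ → Env → Env
(P ∷ₑ ρ) zero    = P
(P ∷ₑ ρ) (suc n) = ρ n

⟦_⟧ : Ty → Env → Pred Tm 0ℓ
⟦ tv n ⟧  ρ = ρ n
⟦ A ⊸ B ⟧ ρ = FunLike
⟦ A ⇒ B ⟧ ρ = FunLike
⟦ § A ⟧   ρ = ⟦ A ⟧ ρ
⟦ ∀ₜ A ⟧  ρ = ⟦ A ⟧ (Stuck ∷ₑ ρ)
⟦ Bool ⟧  ρ = BoolLike

⟦§^⟧ : ∀ n A ρ → ⟦ §^ n A ⟧ ρ ≡ ⟦ A ⟧ ρ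
⟦§^⟧ zero    A ρ = refl
⟦§^⟧ (suc n) A ρ = ⟦§^⟧ n A ρ

Admissible : Env → Set
Admissible ρ = ∀ n → Stuck ⊆ ρ n

admissible-∷ : ∀ {ρ} → Admissible ρ → Admissible (Stuck ∷ₑ ρ)
admissible-∷ adm zero    = λ stuck → stuck
admissible-∷ adm (suc n) = adm n

stuck-⟦⟧ : ∀ A {ρ} → Admissible ρ → Stuck ⊆ ⟦ A ⟧ ρ
stuck-⟦⟧ (tv n)  adm = adm n
stuck-⟦⟧ (A ⊸ B) adm = stuck-funLike
stuck-⟦⟧ (A ⇒ B) adm = stuck-funLike
stuck-⟦⟧ (§ A)   adm = stuck-⟦⟧ A adm
stuck-⟦⟧ (∀ₜ A)  adm = stuck-⟦⟧ A (admissible-∷ adm)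
stuck-⟦⟧ Bool    adm = stuck-boolLike

-- type variables occur only positively in the interpretation
⟦⟧-mono : ∀ A {ρ ρ'} → (∀ n → ρ n ⊆ ρ' n) → ⟦ A ⟧ ρ ⊆ ⟦ A ⟧ ρ'
⟦⟧-mono (tv n)  ρ⊆ρ' = ρ⊆ρ' n
⟦⟧-mono (A ⊸ B) ρ⊆ρ' = λ p → p
⟦⟧-mono (A ⇒ B) ρ⊆ρ' = λ p → p
⟦⟧-mono (§ A)   ρ⊆ρ' = ⟦⟧-mono A ρ⊆ρ'
⟦⟧-mono (∀ₜ A)  ρ⊆ρ' = ⟦⟧-mono A extend
  where extend : ∀ n → (Stuck ∷ₑ _) n ⊆ (Stuck ∷ₑ _) n
        extend zero    = λ p → p
        extend (suc n) = ρ⊆ρ' n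
⟦⟧-mono Bool    ρ⊆ρ' = λ p → p

-- the position of variable n after a fresh variable is inserted at c
skipVar : ℕ → ℕ → ℕ
skipVar c n = if n <ᵇ c then n else suc n

⟦shift⟧ : ∀ c A {ρ ρ'} → (∀ n → ρ (skipVar c n) ≡ ρ' n) →
          ⟦ shiftT c A ⟧ ρ ≡ ⟦ A ⟧ ρ'
⟦shift⟧ c (tv n)  e with n <ᵇ c | e n
... | true  | eq = eq
... | false | eq = eq
⟦shift⟧ c (A ⊸ B) e = refl
⟦shift⟧ c (A ⇒ B) e = refl
⟦shift⟧ c (§ A)   e = ⟦shift⟧ c A e
⟦shift⟧ c (∀ₜ A) {ρ} {ρ'} e = ⟦shift⟧ (suc c) A extend
  where extend : ∀ n → (Stuck ∷ₑ ρ) (skipVar (suc c) n) ≡ (Stuck ∷ₑ ρ') n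
        extend zero    = refl
        extend (suc n) with n <ᵇ c | e n
        ... | true  | eq = eq
        ... | false | eq = eq
⟦shift⟧ c Bool    e = refl

⟦shift₀⟧ : ∀ A P ρ → ⟦ shiftT 0 A ⟧ (P ∷ₑ ρ) ≡ ⟦ A ⟧ ρ
⟦shift₀⟧ A P ρ = ⟦shift⟧ 0 A (λ n → refl)

insert : ℕ → Pred Tm 0ℓ → Env → Env
insert zero    P ρ         = P ∷ₑ ρ
insert (suc c) P ρ zero    = ρ zero
insert (suc c) P ρ (suc n) = insert c P (λ m → ρ (suc m)) n

dropₑ : ℕ → Env → Env
dropₑ c ρ n = ρ (c + n)

⟦substVar⟧ : ∀ c B n ρ → ⟦ substVar c B n ⟧ ρ ≡ insert c (⟦ B ⟧ (dropₑ c ρ)) ρ n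
⟦substVar⟧ zero    B zero    ρ = refl
⟦substVar⟧ zero    B (suc n) ρ = refl
⟦substVar⟧ (suc c) B zero    ρ = refl
⟦substVar⟧ (suc c) B (suc n) ρ =
  trans (⟦shift⟧ 0 (substVar c B n) λ m → refl)
        (⟦substVar⟧ c B n (λ m → ρ (suc m)))

⟦subst⟧ : ∀ c B A {ρ ρ'} → (∀ n → insert c (⟦ B ⟧ (dropₑ c ρ)) ρ n ≡ ρ' n) →
          ⟦ substT c B A ⟧ ρ ≡ ⟦ A ⟧ ρ'
⟦subst⟧ c B (tv n)   {ρ} e = trans (⟦substVar⟧ c B n ρ) (e n)
⟦subst⟧ c B (A ⊸ A') e = refl
⟦subst⟧ c B (A ⇒ A') e = refl
⟦subst⟧ c B (§ A)    e = ⟦subst⟧ c B A e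
⟦subst⟧ c B (∀ₜ A)   e = ⟦subst⟧ (suc c) B A extend
  where extend : ∀ n → insert (suc c) _ (Stuck ∷ₑ _) n ≡ (Stuck ∷ₑ _) n
        extend zero    = refl
        extend (suc n) = e n
⟦subst⟧ c B Bool     e = refl

⟦inst⟧ : ∀ A B ρ → ⟦ A [ B ]ₜ ⟧ ρ ≡ ⟦ A ⟧ (⟦ B ⟧ ρ ∷ₑ ρ)
⟦inst⟧ A B ρ = ⟦subst⟧ 0 B A at
  where at : ∀ n → insert 0 (⟦ B ⟧ ρ) ρ n ≡ (⟦ B ⟧ ρ ∷ₑ ρ) n
        at zero    = refl
        at (suc n) = refl

-- instantiating a quantifier only weakens the interpretation: it reads
-- the bound variable as Stuck, the smallest predicate in question
∀-elim : ∀ A B {ρ} → Admissible ρ → ⟦ ∀ₜ A ⟧ ρ ⊆ ⟦ A [ B ]ₜ ⟧ ρ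
∀-elim A B {ρ} adm p =
  subst (λ P → P _) (sym (⟦inst⟧ A B ρ)) (⟦⟧-mono A stuck⊆B p)
  where stuck⊆B : ∀ n → (Stuck ∷ₑ ρ) n ⊆ (⟦ B ⟧ ρ ∷ₑ ρ) n
        stuck⊆B zero    = stuck-⟦⟧ B adm
        stuck⊆B (suc n) = λ q → q

SlotOK : Env → Slot → Pred Tm 0ℓ
SlotOK ρ ○        t = ⊤
SlotOK ρ (lin A)  t = ⟦ A ⟧ ρ t
SlotOK ρ (nlin A) t = ⟦ A ⟧ ρ t

Respects : Env → Ctx → (ℕ → Tm) → Set
Respects ρ Ψ σ = ∀ i s → lookupC Ψ i ≡ just s → SlotOK ρ s (σ i)

slot-unique : ∀ {m : Maybe Slot} {s s'} → m ≡ just s → m ≡ just s' → s ≡ s'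
slot-unique p q = just-injective (trans (sym p) q)

record _⊑_ (Ψ Ψ' : Ctx) : Set where
  constructor covered
  field declared : ∀ i s → lookupC Ψ i ≡ just s → s ≡ ○ ⊎ lookupC Ψ' i ≡ just s
open _⊑_

respects-⊑ : ∀ {ρ Ψ Ψ' σ} → Ψ ⊑ Ψ' → Respects ρ Ψ' σ → Respects ρ Ψ σ
respects-⊑ Ψ⊑Ψ' R i s e with declared Ψ⊑Ψ' i s e
... | inj₁ refl = tt
... | inj₂ e'   = R i s e'

merge-left : ∀ {a b c} → Merge a b c → a ⊑ c
merge-left m = covered (go m)
  where go : ∀ {a b c} → Merge a b c → ∀ i s → lookupC a i ≡ just s → s ≡ ○ ⊎ lookupC c i ≡ just s
        go (l m) zero    s e = inj₂ e
        go (r m) zero    s e = inj₁ (sym (just-injective e))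
        go (l m) (suc i) s e = go m i s e
        go (r m) (suc i) s e = go m i s e

merge-right : ∀ {a b c} → Merge a b c → b ⊑ c
merge-right m = covered (go m)
  where go : ∀ {a b c} → Merge a b c → ∀ i s → lookupC b i ≡ just s → s ≡ ○ ⊎ lookupC c i ≡ just s
        go (l m) zero    s e = inj₁ (sym (just-injective e))
        go (r m) zero    s e = inj₂ e
        go (l m) (suc i) s e = go m i s e
        go (r m) (suc i) s e = go m i s e

≼⇒⊑ : ∀ {a b} → a ≼ b → a ⊑ b
≼⇒⊑ w = covered (go w)
  where go : ∀ {a b} → a ≼ b → ∀ i s → lookupC a i ≡ just s → s ≡ ○ ⊎ lookupC b i ≡ just s
        go (skip w) zero    s e = inj₁ (sym (just-injective e))
        go (keep w) zero    s e = inj₂ e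
        go (skip w) (suc i) s e = go w i s e
        go (keep w) (suc i) s e = go w i s e

-- the premise of (§i) puts the same requirements as its conclusion,
-- since § is transparent
respects-sec : ∀ {ρ a b σ} → SecCtx a b → Respects ρ b σ → Respects ρ a σ
respects-sec (emp S) R zero    s refl = tt
respects-sec (toΓ S) R zero    s refl = R zero _ refl
respects-sec (toΔ S) R zero    s refl = R zero _ refl
respects-sec (emp S) R (suc i) s e    = respects-sec S (λ j → R (suc j)) i s e
respects-sec (toΓ S) R (suc i) s e    = respects-sec S (λ j → R (suc j)) i s e
respects-sec (toΔ S) R (suc i) s e    = respects-sec S (λ j → R (suc j)) i s e

respects-shift : ∀ {ρ} Ψ {σ} P → Respects ρ Ψ σ → Respects (P ∷ₑ ρ) (map shiftS Ψ) σ
respects-shift (○ ∷ Ψ)      P R zero    s refl = tt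
respects-shift (lin A ∷ Ψ)  P R zero    s refl =
  subst (λ Q → Q _) (sym (⟦shift₀⟧ A P _)) (R zero (lin A) refl)
respects-shift (nlin A ∷ Ψ) P R zero    s refl =
  subst (λ Q → Q _) (sym (⟦shift₀⟧ A P _)) (R zero (nlin A) refl)
respects-shift (_ ∷ Ψ)      P R (suc i) s e    = respects-shift Ψ P (λ j → R (suc j)) i s e

respects-empty : ∀ {ρ Ψ σ} → Empty Ψ → Respects ρ Ψ σ
respects-empty (refl ∷ E)         zero    s refl = tt
respects-empty {σ = σ} (_ ∷ E) (suc i) s e    = respects-empty {σ = λ n → σ (suc n)} E i s e

lookup-Id : ∀ (A : Ty) i → lookupC (replicate i ○ ++ lin A ∷ []) i ≡ just (lin A)
lookup-Id A zero    = refl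
lookup-Id A (suc i) = lookup-Id A i

lookup-upd-≡ : ∀ Ψ i s {s₀} → lookupC Ψ i ≡ just s₀ → lookupC (upd Ψ i s) i ≡ just s
lookup-upd-≡ (_ ∷ Ψ) zero    s e = refl
lookup-upd-≡ (_ ∷ Ψ) (suc i) s e = lookup-upd-≡ Ψ i s e

lookup-upd-≢ : ∀ Ψ i n s → n ≢ i → lookupC (upd Ψ i s) n ≡ lookupC Ψ n
lookup-upd-≢ []      i       n       s n≢i = refl
lookup-upd-≢ (_ ∷ Ψ) zero    zero    s n≢i = ⊥-elim (n≢i refl)
lookup-upd-≢ (_ ∷ Ψ) zero    (suc n) s n≢i = refl
lookup-upd-≢ (_ ∷ Ψ) (suc i) zero    s n≢i = refl
lookup-upd-≢ (_ ∷ Ψ) (suc i) (suc n) s n≢i = lookup-upd-≢ Ψ i n s (λ e → n≢i (cong suc e))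

respects-cntr : ∀ {ρ A σ} Ψ i j k →
  lookupC Ψ i ≡ just (nlin A) → lookupC Ψ j ≡ just (nlin A) →
  lookupC (upd (upd Ψ i ○) j ○) k ≡ just ○ →
  Respects ρ (upd (upd (upd Ψ i ○) j ○) k (nlin A)) σ →
  Respects ρ Ψ (λ n → σ (cntrR i j k n))
respects-cntr {ρ} {A} {σ} Ψ i j k li lj lk R = respects
  where
  cleared : Ctx
  cleared = upd (upd Ψ i ○) j ○
  σk : ⟦ A ⟧ ρ (σ k)
  σk = R k (nlin A) (lookup-upd-≡ cleared k (nlin A) lk)
  unchanged : ∀ {n} → n ≢ i → n ≢ j → lookupC cleared n ≡ lookupC Ψ n
  unchanged {n} n≢i n≢j = trans (lookup-upd-≢ (upd Ψ i ○) j n ○ n≢j) (lookup-upd-≢ Ψ i n ○ n≢i)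
  other : ∀ {n s} → n ≢ i → n ≢ j → lookupC Ψ n ≡ just s → SlotOK ρ s (σ n)
  other {n} n≢i n≢j e with n ≟ k
  ... | yes refl with slot-unique lk (trans (unchanged n≢i n≢j) e)
  ...   | refl = tt
  other {n} {s} n≢i n≢j e | no n≢k =
    R n s (trans (lookup-upd-≢ cleared k n (nlin A) n≢k) (trans (unchanged n≢i n≢j) e))
  respects : Respects ρ Ψ (λ n → σ (cntrR i j k n))
  respects n s e with n ≟ i | n ≟ j
  ... | yes refl | _ with slot-unique li e
  ...   | refl = σk
  respects n s e | no _ | yes refl with slot-unique lj e
  ...   | refl = σk
  respects n s e | no n≢i | no n≢j = other n≢i n≢j e

sound : ∀ {Ψ t A} → Ψ ⊢ t ∶ A → ∀ {ρ σ} → Admissible ρ → Respects ρ Ψ σ →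
        ⟦ A ⟧ ρ (sub σ t)
sound (Id {A} i) adm R = R i (lin A) (lookup-Id A i)
sound (⊸i d) adm R = lam-funLike _
sound (⇒i d) adm R = lam-funLike _
sound (⊸e {B = B} d _ m) adm R =
  stuck-⟦⟧ B adm (app-stuck _ (sound d adm (respects-⊑ (merge-left m) R)))
sound (⇒e {B = B} d _ _ m) adm R =
  stuck-⟦⟧ B adm (app-stuck _ (sound d adm (respects-⊑ (merge-left m) R)))
sound (Weak d w) adm R = sound d adm (respects-⊑ (≼⇒⊑ w) R)
sound (Cntr {Ψ} {t} {B = B} i j k _ li lj lk d) {ρ} {σ} adm R =
  subst (⟦ B ⟧ ρ) (sym (sub-ren σ (cntrR i j k) t))
    (sound d adm (respects-cntr Ψ i j k li lj lk R))
sound (§i d S) adm R = sound d adm (respects-sec S R)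
sound (§e {Ψ₂ = Ψ₂} {t = t} {u = u} {B = B} x du lx dt m) {ρ} {σ} adm R =
  subst (⟦ B ⟧ ρ) (sym (sub-sub σ (substAt x u) t)) (sound dt adm R₂)
  where
  R₂ : Respects ρ Ψ₂ (λ n → sub σ (substAt x u n))
  R₂ n s e with n ≟ x
  ... | yes refl with slot-unique lx e
  ...   | refl = sound du adm (respects-⊑ (merge-left m) R)
  R₂ n s e | no n≢x =
    respects-⊑ (merge-right m) R n s (trans (lookup-upd-≢ Ψ₂ x n ○ n≢x) e)
sound (∀i {Ψ = Ψ} d) adm R = sound d (admissible-∷ adm) (respects-shift Ψ Stuck R)
sound (∀e {A = A} B d) adm R = ∀-elim A B adm (sound d adm R)
sound B₀i adm R = (λ _ ()) , λ _ → inj₂ refl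
sound B₁i adm R = (λ _ ()) , λ _ → inj₁ refl
sound (Be {A = A} k d _ _) {ρ} adm R =
  stuck-⟦⟧ A adm (ite-stuck _ _ (subst (λ P → P _) (⟦§^⟧ k Bool ρ) (sound d adm R)))

lemma4 : ∀ {Ψ : Ctx} {t : Tm} {n : ℕ} → Empty Ψ → Ψ ⊢ t ∶ §^ n Bool →
    (∀ (u : Tm) → t ≢ lam u) × (Normal t → t ≡ tT ⊎ t ≡ tF)
lemma4 {t = t} {n} closed d = subst BoolLike (sub-id t) boolLike
  where
  ρ₀ : Env
  ρ₀ _ = Stuck
  boolLike : BoolLike (sub var t)
  boolLike = subst (λ P → P (sub var t)) (⟦§^⟧ n Bool ρ₀)
               (sound d (λ _ stuck → stuck) (respects-empty closed))
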